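{- For every positive integer $T$, there exists a set $P$ of distinct primes with (1) $|P|=O(\log T)$ and (2) $\log T<p<500\log T$ for every $p\in P$, such that the Chinese Remainder Code with basis $P$ and message space $\mathbb{Z}_T$ has rate $\frac12$ and can correct up to a $\left(\frac14-O\!\left(\frac{1}{\log\log T}\right)\right)$-fraction of errors.
   Context: Let $p_1<p_2<\dots<p_N$ be distinct primes and $K<N$. The Chinese Remainder Code (CRT code) with basis $p_1,\dots,p_N$ and rate $K/N$ over message space $\mathbb{Z}_T$, where $T\le\prod_{i=1}^K p_i$, encodes $m\in\mathbb{Z}_T=\{0,\dots,T-1\}$ as the tuple $\langle [m]_{p_1},\dots,[m]_{p_N}\rangle$, where $[m]_p$ denotes $m \bmod p$. The code can correct up to a $\gamma$-fraction of errors if there is a decoding algorithm that, given any tuple differing from the encoding of some $m\in\mathbb{Z}_T$ in at most $\gamma N$ coordinates, outputs $m$. Logarithms are base 2. -}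

module Defs where

open import Data.Nat using (ℕ; zero; suc; _+_; _*_; _^_; _≤_; _<_; _%_)
open import Data.Nat.Logarithm using (⌊log₂_⌋)
open import Data.Nat.Primality using (Prime)
open import Data.Fin as Fin using (Fin; _↑ˡ_)
open import Data.Bool using (if_then_else_)
open import Data.Product using (Σ; _×_; ∃-syntax)
open import Relation.Nullary.Decidable using (⌊_⌋)
open import Relation.Binary.PropositionalEquality using (_≡_)
open import Function using (_∘_)

-- [ m ]_q : residue of m modulo q (q is always a prime ≥ 2 below;
-- the q = 0 clause is a dummy needed only to make the function total).
modℕ : ℕ → ℕ → ℕ
modℕ m zero    = m
modℕ m (suc k) = m % suc k

prodF : ∀ {n} → (Fin n → ℕ) → ℕ
prodF {zero}  f = 1
prodF {suc n} f = f Fin.zero * prodF (f ∘ Fin.suc)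

hamming : ∀ {n} → (Fin n → ℕ) → (Fin n → ℕ) → ℕ
hamming {zero}  u v = 0
hamming {suc n} u v =
  (if ⌊ u Fin.zero Data.Nat.≟ v Fin.zero ⌋ then 0 else 1) + hamming (u ∘ Fin.suc) (v ∘ Fin.suc)

-- strictly increasing basis p₁ < p₂ < … < p_N (hence distinct)
StrictlyIncreasing : ∀ {n} → (Fin n → ℕ) → Set
StrictlyIncreasing p = ∀ i j → i Fin.< j → p i < p j

crtEncode : ∀ {n} → (Fin n → ℕ) → ℕ → (Fin n → ℕ)
crtEncode p m i = modℕ m (p i)

-- CRT code with basis p (of length K + K, i.e. rate K/N = 1/2), message space ℤ_T
-- (requires 0 < K, i.e. K < N, and T ≤ p₁⋯p_K)
IsRateHalfCRTCode : (K : ℕ) → (Fin (K + K) → ℕ) → ℕ → Set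
IsRateHalfCRTCode K p T =
  0 < K × (∀ i → Prime (p i)) × StrictlyIncreasing p × T ≤ prodF (λ i → p (i ↑ˡ K))

CorrectsErrors : ∀ {n} → (Fin n → ℕ) → ℕ → (ℕ → Set) → Set
CorrectsErrors {n} p T Admissible =
  Σ ((Fin n → ℕ) → ℕ) λ dec →
    ∀ m → m < T → ∀ (w : Fin n → ℕ) → Admissible (hamming w (crtEncode p m)) → dec w ≡ m

loglog : ℕ → ℕ
loglog T = ⌊log₂ ⌊log₂ T ⌋ ⌋

-- e ≤ (1/4 − D / L) · N   (L = loglog T), cleared of denominators (multiply by 4L):
--   4·e·L + 4·D·N ≤ N·L
WithinFraction : (D N T e : ℕ) → Set
WithinFraction D N T e = 4 * e * loglog T + 4 * D * N ≤ N * loglog T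

-- Take the 2K smallest primes above L = 4 ^ c, the least power of 4 exceeding log T, with K ≈ L / c,
-- so that L ^ K ≥ T. If the codewords of m ≤ m′ < T agree in K places, the primes there all divide
-- m′ − m and their product is at least L ^ K ≥ T > m′ − m, so m = m′: the minimum distance exceeds K
-- and nearest-codeword decoding corrects a quarter of the coordinates (whence D = 0).
-- That (L, 64 L] holds 2K primes is Chebyshev's argument: lcm(1, …, 64 L) ≥ 2 ^ (64 L − 1), whereas it
-- divides (s !) ^ k times the primorial of 64 L for s = √(64 L), and the primes up to L contribute at
-- most 4 ^ L (Erdős), so the primes in the window must make up the rest.

module Submission where

open import Defs
open import Data.Bool using (true; false)
open import Data.Fin using (Fin; zero; suc; toℕ; fromℕ<; inject≤; _↑ˡ_)
open import Data.Fin.Properties using (any?; toℕ<n; toℕ-fromℕ<; toℕ-inject≤)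
open import Data.List using (List; []; _∷_; _∷ʳ_; _++_; length; applyUpTo; filter; lookup)
open import Data.List.Membership.Propositional using (_∈_)
open import Data.List.Membership.Propositional.Properties using (∈-lookup)
open import Data.List.Properties using (applyUpTo-∷ʳ; ++-identityʳ; length-filter)
open import Data.List.Relation.Unary.All as All using (All; []; _∷_)
open import Data.List.Relation.Unary.All.Properties using (all-filter; filter⁺)
open import Data.List.Relation.Unary.AllPairs as AllPairs using (AllPairs; []; _∷_)
open import Data.List.Relation.Unary.Any using (here; there)
open import Data.Nat
open import Data.Nat.Combinatorics using (_C_; nC1≡n; nCk+nC[k+1]≡[n+1]C[k+1]; nCk≡nC[n∸k])
open import Data.Nat.Combinatorics.Specification using (k>n⇒nCk≡0)
open import Data.Nat.Divisibility
open import Data.Nat.DivMod using (_/_; _%_; m/n*n≤m; m/n≤m; m≡m%n+[m/n]*n; m%n<n)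
open import Data.Nat.Induction using (<-rec)
open import Data.Nat.ListAction using (sum; product)
open import Data.Nat.ListAction.Properties using (sum-++; product-++; ∈⇒∣product)
open import Data.Nat.Logarithm using (⌊log₂_⌋; ⌊log₂⌋-mono-≤; ⌊log₂[2^n]⌋≡n; ⌊log₂⌊n/2⌋⌋≡⌊log₂n⌋∸1)
open import Data.Nat.Primality
  using (Prime; prime?; prime[2]; ¬prime[1]; euclidsLemma; prime⇒irreducible; prime⇒nonTrivial;
         productOfPrimes≢0; productOfPrimes≥1)
open import Data.Nat.Primality.Factorisation using (PrimeFactorisation; factorise)
open import Data.Nat.Properties
open import Data.Nat.Tactic.RingSolver using (solve-∀)
open import Data.Product using (Σ; _×_; ∃-syntax; _,_; proj₁; proj₂)
open import Data.Sum using (inj₁; inj₂)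
open import Function using (_∘_)
open import Relation.Binary.PropositionalEquality
open import Relation.Nullary using (¬_; yes; no; does; contradiction)
open import Relation.Unary using (Decidable)
open import Relation.Unary.Properties using (∁?)
open import Algebra.Properties.CommutativeSemigroup *-commutativeSemigroup using (x∙yz≈y∙xz)
open import Algebra.Properties.CommutativeSemigroup +-commutativeSemigroup
  using () renaming (interchange to +-interchange; x∙yz≈y∙xz to m+[n+o]≡n+[m+o])

-- Binomial coefficients

pascal : ∀ n k → suc n C suc k ≡ n C k + n C suc k
pascal n k = sym (nCk+nC[k+1]≡[n+1]C[k+1] n k)

k≤n⇒nCk>0 : ∀ {n k} → k ≤ n → 0 < n C k
k≤n⇒nCk>0 {n}     {zero}  _         = z<s
k≤n⇒nCk>0 {suc n} {suc k} (s≤s k≤n) = begin-strict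
  0                     <⟨ k≤n⇒nCk>0 k≤n ⟩
  n C k                 ≤⟨ m≤m+n (n C k) _ ⟩
  n C k + n C suc k     ≡⟨ pascal n k ⟨
  suc n C suc k         ∎
  where open ≤-Reasoning

[1+k]*[1+n]C[1+k]≡[1+n]*nCk : ∀ n k → suc k * (suc n C suc k) ≡ suc n * (n C k)
[1+k]*[1+n]C[1+k]≡[1+n]*nCk n       zero    = begin
  1 * (suc n C 1)  ≡⟨ *-identityˡ _ ⟩
  suc n C 1        ≡⟨ nC1≡n (suc n) ⟩
  suc n            ≡⟨ *-identityʳ (suc n) ⟨
  suc n * 1        ∎
  where open ≡-Reasoning
[1+k]*[1+n]C[1+k]≡[1+n]*nCk zero    (suc k) = *-zeroʳ (2 + k)
[1+k]*[1+n]C[1+k]≡[1+n]*nCk (suc n) (suc k) = begin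
  (2 + k) * ((2 + n) C (2 + k))                    ≡⟨ cong ((2 + k) *_) (pascal (suc n) (suc k)) ⟩
  (2 + k) * (c + c′)                               ≡⟨ distribute k c c′ ⟩
  (1 + k) * c + c + (2 + k) * c′                   ≡⟨ cong₂ (λ u v → u + c + v) ([1+k]*[1+n]C[1+k]≡[1+n]*nCk n k) ([1+k]*[1+n]C[1+k]≡[1+n]*nCk n (suc k)) ⟩
  (1 + n) * a + c + (1 + n) * b                    ≡⟨ cong (λ x → (1 + n) * a + x + (1 + n) * b) (pascal n k) ⟩
  (1 + n) * a + (a + b) + (1 + n) * b              ≡⟨ collect n a b ⟩
  (2 + n) * (a + b)                                ≡⟨ cong ((2 + n) *_) (pascal n k) ⟨
  (2 + n) * c                                      ∎
  where
  open ≡-Reasoning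
  a b c c′ : ℕ
  a = n C k
  b = n C suc k
  c = suc n C suc k
  c′ = suc n C (2 + k)
  distribute : ∀ k c d → (2 + k) * (c + d) ≡ (1 + k) * c + c + (2 + k) * d
  distribute = solve-∀
  collect : ∀ n x y → (1 + n) * x + (x + y) + (1 + n) * y ≡ (2 + n) * (x + y)
  collect = solve-∀

[2+n]*[1+n]Ck≡[1+n]*nCk+[1+k]*[1+n]Ck : ∀ n k → (2 + n) * (suc n C k) ≡ suc n * (n C k) + suc k * (suc n C k)
[2+n]*[1+n]Ck≡[1+n]*nCk+[1+k]*[1+n]Ck n zero    = split n
  where
  split : ∀ n → (2 + n) * 1 ≡ (1 + n) * 1 + 1 * 1
  split = solve-∀
[2+n]*[1+n]Ck≡[1+n]*nCk+[1+k]*[1+n]Ck n (suc k) = begin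
  (2 + n) * c                         ≡⟨ split n c ⟩
  (1 + n) * c + c                     ≡⟨ cong (λ x → (1 + n) * x + c) (pascal n k) ⟩
  (1 + n) * (a + b) + c               ≡⟨ distribute n a b c ⟩
  (1 + n) * a + ((1 + n) * b + c)     ≡⟨ cong (_+ ((1 + n) * b + c)) ([1+k]*[1+n]C[1+k]≡[1+n]*nCk n k) ⟨
  (1 + k) * c + ((1 + n) * b + c)     ≡⟨ collect k n b c ⟩
  (1 + n) * b + (2 + k) * c           ∎
  where
  open ≡-Reasoning
  a b c : ℕ
  a = n C k
  b = n C suc k
  c = suc n C suc k
  split : ∀ n c → (2 + n) * c ≡ (1 + n) * c + c
  split = solve-∀
  distribute : ∀ n a b c → (1 + n) * (a + b) + c ≡ (1 + n) * a + ((1 + n) * b + c)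
  distribute = solve-∀
  collect : ∀ k n b c → (1 + k) * c + ((1 + n) * b + c) ≡ (1 + n) * b + (2 + k) * c
  collect = solve-∀

sum-applyUpTo-suc : ∀ f n → sum (applyUpTo f (suc n)) ≡ sum (applyUpTo f n) + f n
sum-applyUpTo-suc f n = begin
  sum (applyUpTo f (suc n))         ≡⟨ cong sum (applyUpTo-∷ʳ f n) ⟨
  sum (applyUpTo f n ∷ʳ f n)        ≡⟨ sum-++ (applyUpTo f n) (f n ∷ []) ⟩
  sum (applyUpTo f n) + (f n + 0)   ≡⟨ cong (sum (applyUpTo f n) +_) (+-identityʳ (f n)) ⟩
  sum (applyUpTo f n) + f n         ∎
  where open ≡-Reasoning

sum-applyUpTo-+ : ∀ {f g h} n → (∀ k → h k ≡ f k + g k) →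
                  sum (applyUpTo h n) ≡ sum (applyUpTo f n) + sum (applyUpTo g n)
sum-applyUpTo-+ zero    h≡f+g = refl
sum-applyUpTo-+ {f} {g} (suc n) h≡f+g =
  trans (cong₂ _+_ (h≡f+g 0) (sum-applyUpTo-+ n (h≡f+g ∘ suc))) (+-interchange (f 0) (g 0) _ _)

sum-applyUpTo-* : ∀ c f n → sum (applyUpTo (λ k → c * f k) n) ≡ c * sum (applyUpTo f n)
sum-applyUpTo-* c f zero    = sym (*-zeroʳ c)
sum-applyUpTo-* c f (suc n) =
  trans (cong (c * f 0 +_) (sum-applyUpTo-* c (f ∘ suc) n)) (sym (*-distribˡ-+ c (f 0) _))

sum-applyUpTo-≤ : ∀ f n {x} → (∀ {k} → k < n → f k ≤ x) → sum (applyUpTo f n) ≤ n * x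
sum-applyUpTo-≤ f zero    f≤x = z≤n
sum-applyUpTo-≤ f (suc n) f≤x = +-mono-≤ (f≤x z<s) (sum-applyUpTo-≤ (f ∘ suc) n (f≤x ∘ s<s))

sum-applyUpTo-≥-adjacent : ∀ f {i n} → suc i < n → f i + f (suc i) ≤ sum (applyUpTo f n)
sum-applyUpTo-≥-adjacent f {zero}  {suc zero}    (s<s ())
sum-applyUpTo-≥-adjacent f {zero}  {suc (suc n)} _ = +-monoʳ-≤ (f 0) (m≤m+n (f 1) _)
sum-applyUpTo-≥-adjacent f {suc i} {suc n} (s<s i<n) =
  ≤-trans (sum-applyUpTo-≥-adjacent (f ∘ suc) i<n) (m≤n+m _ (f 0))

∑nCk≡2^n : ∀ n → sum (applyUpTo (n C_) (suc n)) ≡ 2 ^ n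
∑nCk≡2^n zero    = refl
∑nCk≡2^n (suc n) = begin
  1 + sum (applyUpTo (λ k → suc n C suc k) (suc n))   ≡⟨ cong (1 +_) (sum-applyUpTo-+ {n C_} {λ k → n C suc k} (suc n) (pascal n)) ⟩
  1 + (S + S′)                                         ≡⟨ m+[n+o]≡n+[m+o] 1 S S′ ⟩
  S + (1 + S′)                                         ≡⟨ cong (S +_) (sum-applyUpTo-suc (n C_) (suc n)) ⟩
  S + (S + n C suc n)                                  ≡⟨ cong (λ x → S + (S + x)) (k>n⇒nCk≡0 (n<1+n n)) ⟩
  S + (S + 0)                                          ≡⟨ cong (λ x → x + (x + 0)) (∑nCk≡2^n n) ⟩
  2 ^ n + (2 ^ n + 0)                                  ∎
  where
  open ≡-Reasoning
  S S′ : ℕ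
  S = sum (applyUpTo (n C_) (suc n))
  S′ = sum (applyUpTo (λ k → n C suc k) (suc n))

[2m+1]Cm≤4^m : ∀ m → suc (m + m) C m ≤ 2 ^ (m + m)
[2m+1]Cm≤4^m m = *-cancelˡ-≤ 2 (begin
  2 * x                                  ≡⟨ cong (x +_) (+-identityʳ x) ⟩
  x + x                                  ≡⟨ cong (x +_) symmetric ⟩
  x + n C suc m                          ≤⟨ sum-applyUpTo-≥-adjacent (n C_) (s≤s (s≤s (m≤m+n m m))) ⟩
  sum (applyUpTo (n C_) (suc n))         ≡⟨ ∑nCk≡2^n n ⟩
  2 * 2 ^ (m + m)                        ∎)
  where
  open ≤-Reasoning
  n x : ℕ
  n = suc (m + m)
  x = n C m
  symmetric : n C m ≡ n C suc m
  symmetric = trans (nCk≡nC[n∸k] (m≤n⇒m≤1+n (m≤m+n m m)))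
                    (cong (n C_) (trans (+-∸-assoc 1 (m≤m+n m m)) (cong suc (m+n∸n≡m m m))))

prime⇒2≤ : ∀ {p} → Prime p → 2 ≤ p
prime⇒2≤ {p} pp = nonTrivial⇒n>1 p {{prime⇒nonTrivial pp}}

p∣nCk : ∀ {p n k} → Prime p → k < p → p ≤ n → n < p + k → p ∣ n C k
p∣nCk {p} {n}     {zero}  _  _   p≤n n<p+0 = contradiction (subst (n <_) (+-identityʳ p) n<p+0) (≤⇒≯ p≤n)
p∣nCk {p} {zero}  {suc k} pp _   p≤0 _     = contradiction (≤-trans (prime⇒2≤ pp) p≤0) λ ()
p∣nCk {p} {suc n} {suc k} pp k<p p≤n n<p+k with euclidsLemma (suc k) _ pp p∣[1+k]*C
  where
  p∣[1+n]*nCk : p ∣ suc n * (n C k)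
  p∣[1+n]*nCk with p ≟ suc n
  ... | yes refl = m∣m*n (n C k)
  ... | no p≢1+n = ∣n⇒∣m*n (suc n) (p∣nCk pp (<-trans (n<1+n k) k<p) (s≤s⁻¹ (≤∧≢⇒< p≤n p≢1+n))
                                         (s≤s⁻¹ (subst (suc n <_) (+-suc p k) n<p+k)))
  p∣[1+k]*C : p ∣ suc k * (suc n C suc k)
  p∣[1+k]*C = subst (p ∣_) (sym ([1+k]*[1+n]C[1+k]≡[1+n]*nCk n k)) p∣[1+n]*nCk
... | inj₁ p∣1+k = contradiction (∣⇒≤ p∣1+k) (<⇒≱ k<p)
... | inj₂ p∣C   = p∣C

-- A lower bound for lcm(1, …, n)

-- From 1/c = 1/a − 1/(a + d): a multiple of a and of a + d is a multiple of c.
∣-harmonic : ∀ {a d c x} .{{_ : NonZero d}} → c * d ≡ a * (a + d) → a ∣ x → a + d ∣ x → c ∣ x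
∣-harmonic {a} {d} {c} {x} cd≡a[a+d] (divides u x≡ua) (divides v x≡v[a+d]) =
  ∣m+n∣m⇒∣n (subst (c ∣_) cu≡cv+x (m∣m*n u)) (m∣m*n v)
  where
  open ≡-Reasoning
  reassoc : ∀ y → c * y * d ≡ y * (a * (a + d))
  reassoc y = trans (trans (*-assoc c y d) (x∙yz≈y∙xz c y d)) (cong (y *_) cd≡a[a+d])
  xa≡cvd : x * a ≡ c * v * d
  xa≡cvd = begin
    x * a                ≡⟨ cong (_* a) x≡v[a+d] ⟩
    v * (a + d) * a      ≡⟨ *-assoc v (a + d) a ⟩
    v * ((a + d) * a)    ≡⟨ cong (v *_) (*-comm (a + d) a) ⟩
    v * (a * (a + d))    ≡⟨ reassoc v ⟨
    c * v * d            ∎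
  cu≡cv+x : c * u ≡ c * v + x
  cu≡cv+x = *-cancelʳ-≡ (c * u) (c * v + x) d (begin
    c * u * d            ≡⟨ reassoc u ⟩
    u * (a * (a + d))    ≡⟨ *-assoc u a (a + d) ⟨
    u * a * (a + d)      ≡⟨ cong (_* (a + d)) x≡ua ⟨
    x * (a + d)          ≡⟨ *-distribˡ-+ x a d ⟩
    x * a + x * d        ≡⟨ cong (_+ x * d) xa≡cvd ⟩
    c * v * d + x * d    ≡⟨ *-distribʳ-+ d (c * v) x ⟨
    (c * v + x) * d      ∎)

CommonMultipleUpTo : ℕ → ℕ → Set
CommonMultipleUpTo n x = ∀ {j} → 0 < j → j ≤ n → j ∣ x

[1+n]*nCk∣commonMultiple : ∀ {m x} → CommonMultipleUpTo m x → ∀ {n k} → k ≤ n → n < m → suc n * (n C k) ∣ x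
[1+n]*nCk∣commonMultiple {x = x} cm {n}     {zero}  _         n<m = subst (_∣ x) (sym (*-identityʳ (suc n))) (cm z<s n<m)
[1+n]*nCk∣commonMultiple {x = x} cm {suc n} {suc k} (s≤s k≤n) n<m =
  ∣-harmonic {{d≢0}} cd≡a[a+d] ([1+n]*nCk∣commonMultiple cm k≤n (<-trans (n<1+n n) n<m))
             (subst (_∣ x) b≡a+d ([1+n]*nCk∣commonMultiple cm (m≤n⇒m≤1+n k≤n) n<m))
  where
  open ≡-Reasoning
  a d c : ℕ
  a = suc n * (n C k)
  d = suc k * (suc n C k)
  c = (2 + n) * (suc n C suc k)
  b≡a+d : (2 + n) * (suc n C k) ≡ a + d
  b≡a+d = [2+n]*[1+n]Ck≡[1+n]*nCk+[1+k]*[1+n]Ck n k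
  d≢0 : NonZero d
  d≢0 = >-nonZero (*-mono-< {0} {suc k} z<s (k≤n⇒nCk>0 (m≤n⇒m≤1+n k≤n)))
  cd≡a[a+d] : c * d ≡ a * (a + d)
  cd≡a[a+d] = begin
    c * d                                              ≡⟨ swap (2 + n) (suc n C suc k) (suc k) (suc n C k) ⟩
    (suc k * (suc n C suc k)) * ((2 + n) * (suc n C k)) ≡⟨ cong₂ _*_ ([1+k]*[1+n]C[1+k]≡[1+n]*nCk n k) b≡a+d ⟩
    a * (a + d)                                        ∎
    where
    swap : ∀ w x y z → w * x * (y * z) ≡ (y * x) * (w * z)
    swap = solve-∀

2^n≤commonMultiple : ∀ {n x} → CommonMultipleUpTo (suc n) x → 0 < x → 2 ^ n ≤ x
2^n≤commonMultiple {n} {x} cm x>0 = *-cancelˡ-≤ (suc n) (begin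
  suc n * 2 ^ n                                     ≡⟨ cong (suc n *_) (∑nCk≡2^n n) ⟨
  suc n * sum (applyUpTo (n C_) (suc n))            ≡⟨ sum-applyUpTo-* (suc n) (n C_) (suc n) ⟨
  sum (applyUpTo (λ k → suc n * (n C k)) (suc n))   ≤⟨ sum-applyUpTo-≤ _ (suc n) term≤x ⟩
  suc n * x                                         ∎)
  where
  open ≤-Reasoning
  term≤x : ∀ {k} → k < suc n → suc n * (n C k) ≤ x
  term≤x k<1+n = ∣⇒≤ {{>-nonZero x>0}} ([1+n]*nCk∣commonMultiple cm (s≤s⁻¹ k<1+n) ≤-refl)

-- Primes in an interval

primesIn : ℕ → ℕ → List ℕ
primesIn lo zero    = []
primesIn lo (suc d) with prime? (suc lo)
... | yes _ = suc lo ∷ primesIn (suc lo) d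
... | no  _ = primesIn (suc lo) d

InWindow : ℕ → ℕ → ℕ → Set
InWindow lo d q = Prime q × lo < q × q ≤ lo + d

inWindow-suc : ∀ {lo d q} → InWindow (suc lo) d q → InWindow lo (suc d) q
inWindow-suc {lo} {d} (pq , lo<q , q≤) = pq , <-trans (n<1+n lo) lo<q , ≤-trans q≤ (≤-reflexive (sym (+-suc lo d)))

primesIn-inWindow : ∀ lo d → All (InWindow lo d) (primesIn lo d)
primesIn-inWindow lo zero    = []
primesIn-inWindow lo (suc d) with prime? (suc lo)
... | yes p = (p , n<1+n lo , subst (suc lo ≤_) (sym (+-suc lo d)) (s≤s (m≤m+n lo d)))
              ∷ All.map inWindow-suc (primesIn-inWindow (suc lo) d)
... | no  _ = All.map inWindow-suc (primesIn-inWindow (suc lo) d)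

primesIn-prime : ∀ lo d → All Prime (primesIn lo d)
primesIn-prime lo d = All.map proj₁ (primesIn-inWindow lo d)

∈-primesIn : ∀ {lo d q} → Prime q → lo < q → q ≤ lo + d → q ∈ primesIn lo d
∈-primesIn {lo} {zero}  _  lo<q q≤lo+0 = contradiction (subst (_ ≤_) (+-identityʳ lo) q≤lo+0) (<⇒≱ lo<q)
∈-primesIn {lo} {suc d} {q} pq lo<q q≤ with prime? (suc lo) | q ≟ suc lo
... | yes _    | yes refl = here refl
... | no ¬p    | yes refl = contradiction pq ¬p
... | yes _    | no q≢1+lo = there (∈-primesIn pq (≤∧≢⇒< lo<q (q≢1+lo ∘ sym)) (subst (q ≤_) (+-suc lo d) q≤))
... | no _     | no q≢1+lo = ∈-primesIn pq (≤∧≢⇒< lo<q (q≢1+lo ∘ sym)) (subst (q ≤_) (+-suc lo d) q≤)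

primesIn-increasing : ∀ lo d → AllPairs _<_ (primesIn lo d)
primesIn-increasing lo zero    = []
primesIn-increasing lo (suc d) with prime? (suc lo)
... | yes _ = All.map (proj₁ ∘ proj₂) (primesIn-inWindow (suc lo) d) ∷ primesIn-increasing (suc lo) d
... | no  _ = primesIn-increasing (suc lo) d

primesIn-++ : ∀ lo d e → primesIn lo d ++ primesIn (lo + d) e ≡ primesIn lo (d + e)
primesIn-++ lo zero    e = cong (λ x → primesIn x e) (+-identityʳ lo)
primesIn-++ lo (suc d) e rewrite +-suc lo d with prime? (suc lo)
... | yes _ = cong (suc lo ∷_) (primesIn-++ (suc lo) d e)
... | no  _ = primesIn-++ (suc lo) d e

prime∣prime⇒≡ : ∀ {p q} → Prime p → Prime q → p ∣ q → p ≡ q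
prime∣prime⇒≡ pp pq p∣q with prime⇒irreducible pq p∣q
... | inj₁ refl = contradiction pp ¬prime[1]
... | inj₂ p≡q  = p≡q

prime∣product⇒∈ : ∀ {p ps} → Prime p → All Prime ps → p ∣ product ps → p ∈ ps
prime∣product⇒∈ pp []          p∣1 = contradiction (∣1⇒≡1 p∣1) (nonTrivial⇒≢1 {{prime⇒nonTrivial pp}})
prime∣product⇒∈ {ps = q ∷ qs} pp (pq ∷ pqs) p∣q*∏ with euclidsLemma q (product qs) pp p∣q*∏
... | inj₁ p∣q = here (prime∣prime⇒≡ pp pq p∣q)
... | inj₂ p∣∏ = there (prime∣product⇒∈ pp pqs p∣∏)

product-primes∣ : ∀ {ps x} → All Prime ps → AllPairs _≢_ ps → All (_∣ x) ps → product ps ∣ x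
product-primes∣ []         []           []                 = 1∣ _
product-primes∣ (pp ∷ pps) (p≢ps ∷ dps) (p∣x ∷ ps∣x) with product-primes∣ pps dps ps∣x
... | divides t x≡t*∏ with euclidsLemma t _ pp (subst (_ ∣_) x≡t*∏ p∣x)
...   | inj₁ (divides u t≡u*p) = divides u (trans x≡t*∏ (trans (cong (_* _) t≡u*p) (*-assoc u _ _)))
...   | inj₂ p∣∏ = contradiction refl (All.lookup p≢ps (prime∣product⇒∈ pp pps p∣∏))

product≤^length : ∀ {b ps} → All (_≤ b) ps → product ps ≤ b ^ length ps
product≤^length []           = ≤-refl
product≤^length (p≤b ∷ ps≤b) = *-mono-≤ p≤b (product≤^length ps≤b)

^length≤product : ∀ {b ps} → All (b ≤_) ps → b ^ length ps ≤ product ps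
^length≤product []           = ≤-refl
^length≤product (b≤p ∷ b≤ps) = *-mono-≤ b≤p (^length≤product b≤ps)

primesIn-suc-composite : ∀ lo d → ¬ Prime (suc (lo + d)) → primesIn lo (suc d) ≡ primesIn lo d
primesIn-suc-composite lo d ¬p = begin
  primesIn lo (suc d)                    ≡⟨ cong (primesIn lo) (+-comm 1 d) ⟩
  primesIn lo (d + 1)                    ≡⟨ primesIn-++ lo d 1 ⟨
  primesIn lo d ++ primesIn (lo + d) 1   ≡⟨ cong (primesIn lo d ++_) no-new-prime ⟩
  primesIn lo d ++ []                    ≡⟨ ++-identityʳ (primesIn lo d) ⟩
  primesIn lo d                          ∎
  where
  open ≡-Reasoning
  no-new-prime : primesIn (lo + d) 1 ≡ []
  no-new-prime with prime? (suc (lo + d))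
  ... | yes p = contradiction p ¬p
  ... | no  _ = refl

product-primesIn∣[2m+1]Cm : ∀ m → product (primesIn (suc m) m) ∣ suc (m + m) C m
product-primesIn∣[2m+1]Cm m =
  product-primes∣ (primesIn-prime (suc m) m) (AllPairs.map <⇒≢ (primesIn-increasing (suc m) m))
                  (All.map divides-binomial (primesIn-inWindow (suc m) m))
  where
  divides-binomial : ∀ {q} → InWindow (suc m) m q → q ∣ suc (m + m) C m
  divides-binomial (pq , 1+m<q , q≤) = p∣nCk pq (<-trans (n<1+n m) 1+m<q) q≤ (+-monoˡ-< m 1+m<q)

data Halving : ℕ → Set where
  even : ∀ m → Halving (m + m)
  odd  : ∀ m → Halving (suc (m + m))

halving : ∀ n → Halving n
halving zero    = even 0
halving (suc n) with halving n
... | even m = odd m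
... | odd  m = subst Halving (cong suc (+-suc m m)) (even (suc m))

-- Erdős's bound: the primes in (m + 1, 2m + 1] divide C(2m + 1, m) ≤ 4 ^ m.
product-primes≤4^n : ∀ n → product (primesIn 0 n) ≤ 2 ^ (n + n)
product-primes≤4^n = <-rec _ bound
  where
  bound : ∀ n → (∀ {n′} → n′ < n → product (primesIn 0 n′) ≤ 2 ^ (n′ + n′)) →
          product (primesIn 0 n) ≤ 2 ^ (n + n)
  bound n rec with halving n
  ... | even zero          = ≤-refl
  ... | even (suc zero)    = m≤m+n 2 14
  ... | even (suc (suc m)) = begin
    product (primesIn 0 (suc n′))  ≡⟨ cong product (primesIn-suc-composite 0 n′ composite) ⟩
    product (primesIn 0 n′)        ≤⟨ rec (n<1+n n′) ⟩
    2 ^ (n′ + n′)                  ≤⟨ ^-monoʳ-≤ 2 (+-mono-≤ (n≤1+n n′) (n≤1+n n′)) ⟩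
    2 ^ (suc n′ + suc n′)          ∎
    where
    open ≤-Reasoning
    n′ : ℕ
    n′ = suc m + suc (suc m)
    composite : ¬ Prime (suc n′)
    composite p = contradiction (prime∣prime⇒≡ prime[2] p (divides (2 + m) (doubling m)))
                               (<⇒≢ (s≤s (s≤s (≤-trans z<s (m≤n+m (suc (suc m)) m)))))
      where
      doubling : ∀ m → suc (suc m + suc (suc m)) ≡ (2 + m) * 2
      doubling = solve-∀
  ... | odd zero           = s≤s z≤n
  ... | odd (suc m)        = begin
    product (primesIn 0 (suc k + k))                       ≡⟨ cong product (primesIn-++ 0 (suc k) k) ⟨
    product (primesIn 0 (suc k) ++ primesIn (suc k) k)     ≡⟨ product-++ (primesIn 0 (suc k)) (primesIn (suc k) k) ⟩
    product (primesIn 0 (suc k)) * product (primesIn (suc k) k)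
      ≤⟨ *-mono-≤ (rec (s≤s (s≤s (m≤n+m (suc m) m)))) middle≤ ⟩
    2 ^ (suc k + suc k) * 2 ^ (k + k)                      ≡⟨ ^-distribˡ-+-* 2 (suc k + suc k) (k + k) ⟨
    2 ^ (suc k + suc k + (k + k))                          ≡⟨ cong (2 ^_) (exponent k) ⟩
    2 ^ (suc k + k + (suc k + k))                          ∎
    where
    open ≤-Reasoning
    k : ℕ
    k = suc m
    middle≤ : product (primesIn (suc k) k) ≤ 2 ^ (k + k)
    middle≤ = ≤-trans (∣⇒≤ {{>-nonZero (k≤n⇒nCk>0 (m≤n+m k (suc k)))}} (product-primesIn∣[2m+1]Cm k)) ([2m+1]Cm≤4^m k)
    exponent : ∀ k → suc k + suc k + (k + k) ≡ suc k + k + (suc k + k)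
    exponent = solve-∀

-- Chebyshev's bound for primes in a window

product-filter : ∀ {P : ℕ → Set} (P? : Decidable P) xs →
                 product xs ≡ product (filter P? xs) * product (filter (∁? P?) xs)
product-filter P? []       = refl
product-filter P? (x ∷ xs) with does (P? x)
... | true  = trans (cong (x *_) (product-filter P? xs)) (sym (*-assoc x _ _))
... | false = trans (cong (x *_) (product-filter P? xs)) (x∙yz≈y∙xz x (product (filter P? xs)) (product (filter (∁? P?) xs)))

n∣m! : ∀ {n m} → 0 < n → n ≤ m → n ∣ m !
n∣m! {suc n} _ n≤m = ∣-trans (m∣m*n (n !)) (m≤n⇒m!∣n! n≤m)

product∣^ : ∀ {x k xs} → All (_∣ x) xs → length xs ≤ k → product xs ∣ x ^ k
product∣^ {k = k}     []           _              = 1∣ _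
product∣^ {k = suc k} (y∣x ∷ ys∣x) (s≤s len≤k) = *-pres-∣ y∣x (product∣^ ys∣x len≤k)

-- A product of primes exceeding s which is at most s * s has at most one factor.
product-large-primes∣primorial : ∀ {s n qs} → All (λ q → Prime q × s < q) qs →
                                 product qs ≤ n → n ≤ s * s → product qs ∣ product (primesIn 0 n)
product-large-primes∣primorial [] _ _ = 1∣ _
product-large-primes∣primorial {n = n} {qs = q ∷ []} ((pq , _) ∷ []) q*1≤n _ =
  subst (_∣ product (primesIn 0 n)) (sym (*-identityʳ q))
        (∈⇒∣product (∈-primesIn {0} {n} pq (<-trans z<s (prime⇒2≤ pq)) (subst (_≤ n) (*-identityʳ q) q*1≤n)))
product-large-primes∣primorial {s} {n} {q ∷ r ∷ rs} ((_ , s<q) ∷ (pr , s<r) ∷ prs) qrrs≤n n≤s*s =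
  contradiction (begin-strict
    s * s                   <⟨ *-mono-< s<q s<r ⟩
    q * r                   ≤⟨ *-monoʳ-≤ q (m≤m*n r (product rs) {{productOfPrimes≢0 (All.map proj₁ prs)}}) ⟩
    q * (r * product rs)    ≤⟨ qrrs≤n ⟩
    n                       ∎) (≤⇒≯ n≤s*s)
  where open ≤-Reasoning

commonMultipleUpTo-smooth*primorial : ∀ {n s k} → n ≤ s * s → n < 2 ^ k →
                                      CommonMultipleUpTo n ((s !) ^ k * product (primesIn 0 n))
commonMultipleUpTo-smooth*primorial {n} {s} {k} n≤s*s n<2^k {j} j>0 j≤n =
  subst (_∣ (s !) ^ k * product (primesIn 0 n)) (sym j≡small*large) (*-pres-∣ small∣ large∣)
  where
  instance
    _ : NonZero j
    _ = >-nonZero j>0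
  open PrimeFactorisation (factorise j) renaming (factors to fs)
  small large : List ℕ
  small = filter (_≤? s) fs
  large = filter (∁? (_≤? s)) fs
  j≡small*large : j ≡ product small * product large
  j≡small*large = trans isFactorisation (product-filter (_≤? s) fs)
  2^length≤j : 2 ^ length fs ≤ j
  2^length≤j = subst (2 ^ length fs ≤_) (sym isFactorisation) (^length≤product (All.map prime⇒2≤ factorsPrime))
  length-fs<k : length fs < k
  length-fs<k = ≰⇒> λ k≤len → <⇒≱ (≤-<-trans 2^length≤j (≤-<-trans j≤n n<2^k)) (^-monoʳ-≤ 2 k≤len)
  small∣ : product small ∣ (s !) ^ k
  small∣ = product∣^ (All.map (λ (q≤s , pq) → n∣m! (<-trans z<s (prime⇒2≤ pq)) q≤s)
                              (All.zip (all-filter (_≤? s) fs , filter⁺ (_≤? s) factorsPrime)))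
                     (≤-trans (length-filter (_≤? s) fs) (<⇒≤ length-fs<k))
  large∣ : product large ∣ product (primesIn 0 n)
  large∣ = product-large-primes∣primorial
    (All.map (λ (q≰s , pq) → pq , ≰⇒> q≰s) (All.zip (all-filter (∁? (_≤? s)) fs , filter⁺ (∁? (_≤? s)) factorsPrime)))
    (≤-trans (∣⇒≤ (divides (product small) j≡small*large)) j≤n) n≤s*s

2^[n∸1]≤smooth*primorial : ∀ {n s k} → 0 < n → n ≤ s * s → n < 2 ^ k →
                           2 ^ (n ∸ 1) ≤ (s !) ^ k * product (primesIn 0 n)
2^[n∸1]≤smooth*primorial {suc n} {s} {k} _ n≤s*s n<2^k =
  2^n≤commonMultiple (commonMultipleUpTo-smooth*primorial {s = s} {k} n≤s*s n<2^k)
                     (*-mono-< {0} {(s !) ^ k} (m^n>0 (s !) {{s !≢0}} k) (productOfPrimes≥1 (primesIn-prime 0 (suc n))))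

n!≤n^n : ∀ n → n ! ≤ n ^ n
n!≤n^n zero    = ≤-refl
n!≤n^n (suc n) = *-monoʳ-≤ (suc n) (≤-trans (n!≤n^n n) (^-monoˡ-≤ n (n≤1+n n)))

product-primesIn≤ : ∀ lo d → product (primesIn lo d) ≤ (lo + d) ^ length (primesIn lo d)
product-primesIn≤ lo d = product≤^length (All.map (proj₂ ∘ proj₂) (primesIn-inWindow lo d))

[c+3]*[2c+7]≤2^c : ∀ {c} → 10 ≤ c → (c + 3) * (c + c + 7) ≤ 2 ^ c
[c+3]*[2c+7]≤2^c {c} 10≤c with m≤n⇒∃[o]m+o≡n 10≤c
... | t , refl = subst ((10 + t + 3) * (10 + t + (10 + t) + 7) ≤_) (sym (^-distribˡ-+-* 2 10 t))
                       (subst (_≤ 1024 * 2 ^ t) (shift t) (bound t))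
  where
  shift : ∀ t → (t + 13) * (t + t + 27) ≡ (10 + t + 3) * (10 + t + (10 + t) + 7)
  shift = solve-∀
  bound : ∀ t → (t + 13) * (t + t + 27) ≤ 1024 * 2 ^ t
  bound zero    = m≤m+n 351 673
  bound (suc t) = begin
    (suc t + 13) * (suc t + suc t + 27)                                 ≤⟨ m≤m+n _ (2 * t * t + 49 * t + 296) ⟩
    (suc t + 13) * (suc t + suc t + 27) + (2 * t * t + 49 * t + 296)    ≡⟨ step t ⟩
    2 * ((t + 13) * (t + t + 27))                                       ≤⟨ *-monoʳ-≤ 2 (bound t) ⟩
    2 * (1024 * 2 ^ t)                                                  ≡⟨ x∙yz≈y∙xz 2 1024 (2 ^ t) ⟩
    1024 * 2 ^ suc t                                                    ∎
    where
    open ≤-Reasoning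
    step : ∀ t → (suc t + 13) * (suc t + suc t + 27) + (2 * t * t + 49 * t + 296) ≡ 2 * ((t + 13) * (t + t + 27))
    step = solve-∀

smooth-exponent≤ : ∀ {c} → 10 ≤ c → (c + 3) * 2 ^ (c + 3) * (c + c + 7) ≤ 8 * 2 ^ (c + c)
smooth-exponent≤ {c} 10≤c = begin
  (c + 3) * 2 ^ (c + 3) * (c + c + 7)       ≡⟨ cong (λ x → (c + 3) * x * (c + c + 7)) (^-distribˡ-+-* 2 c 3) ⟩
  (c + 3) * (2 ^ c * 8) * (c + c + 7)       ≡⟨ reorder (c + 3) (2 ^ c) (c + c + 7) ⟩
  8 * ((c + 3) * (c + c + 7) * 2 ^ c)       ≤⟨ *-monoʳ-≤ 8 (*-monoˡ-≤ (2 ^ c) ([c+3]*[2c+7]≤2^c 10≤c)) ⟩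
  8 * (2 ^ c * 2 ^ c)                       ≡⟨ cong (8 *_) (^-distribˡ-+-* 2 c c) ⟨
  8 * 2 ^ (c + c)                           ∎
  where
  open ≤-Reasoning
  reorder : ∀ a x b → a * (x * 8) * b ≡ 8 * (a * b * x)
  reorder = solve-∀

-- n = 64 L with L = 4 ^ c, s = √n, and every j ≤ n has fewer than k prime factors.
module ChebyshevWindow (c : ℕ) .{{_ : NonZero c}} where

  L n r s k : ℕ
  L = 2 ^ (c + c)
  n = L + 63 * L
  r = length (primesIn L (63 * L))
  s = 2 ^ (c + 3)
  k = c + c + 7

  exponent : ℕ
  exponent = (c + 3) * s * k + (L + L + (c + c + 6) * r)

  L>0 : 0 < L
  L>0 = m^n>0 2 (c + c)

  n≡2^[2c+6] : n ≡ 2 ^ (c + c + 6)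
  n≡2^[2c+6] = trans (times64 L) (sym (^-distribˡ-+-* 2 (c + c) 6))
    where
    times64 : ∀ L → L + 63 * L ≡ L * 64
    times64 = solve-∀

  n≤s*s : n ≤ s * s
  n≤s*s = ≤-reflexive (trans n≡2^[2c+6] (trans (cong (2 ^_) (halves c)) (^-distribˡ-+-* 2 (c + 3) (c + 3))))
    where
    halves : ∀ c → c + c + 6 ≡ c + 3 + (c + 3)
    halves = solve-∀

  n<2^k : n < 2 ^ k
  n<2^k = subst (_< 2 ^ k) (sym n≡2^[2c+6]) (^-monoʳ-< 2 ≤-refl (+-monoʳ-< (c + c) (n<1+n 6)))

  2^[n∸1]≤2^exponent : 2 ^ (n ∸ 1) ≤ 2 ^ exponent
  2^[n∸1]≤2^exponent = begin
    2 ^ (n ∸ 1)                                                ≤⟨ 2^[n∸1]≤smooth*primorial {s = s} {k} (≤-trans L>0 (m≤m+n L _)) n≤s*s n<2^k ⟩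
    (s !) ^ k * product (primesIn 0 n)                         ≡⟨ cong (λ ps → (s !) ^ k * product ps) (primesIn-++ 0 L (63 * L)) ⟨
    (s !) ^ k * product (primesIn 0 L ++ primesIn L (63 * L))  ≡⟨ cong ((s !) ^ k *_) (product-++ (primesIn 0 L) _) ⟩
    (s !) ^ k * (product (primesIn 0 L) * product (primesIn L (63 * L)))
      ≤⟨ *-mono-≤ (^-monoˡ-≤ k (n!≤n^n s)) (*-mono-≤ (product-primes≤4^n L) (product-primesIn≤ L (63 * L))) ⟩
    (s ^ s) ^ k * (2 ^ (L + L) * n ^ r)
      ≡⟨ cong₂ (λ a b → a * (2 ^ (L + L) * b))
               (trans (cong (_^ k) (^-*-assoc 2 (c + 3) s)) (^-*-assoc 2 ((c + 3) * s) k))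
               (trans (cong (_^ r) n≡2^[2c+6]) (^-*-assoc 2 (c + c + 6) r)) ⟩
    2 ^ ((c + 3) * s * k) * (2 ^ (L + L) * 2 ^ ((c + c + 6) * r))
      ≡⟨ cong (2 ^ ((c + 3) * s * k) *_) (^-distribˡ-+-* 2 (L + L) _) ⟨
    2 ^ ((c + 3) * s * k) * 2 ^ (L + L + (c + c + 6) * r)      ≡⟨ ^-distribˡ-+-* 2 ((c + 3) * s * k) _ ⟨
    2 ^ exponent                                               ∎
    where open ≤-Reasoning

  2c+6≤L : 10 ≤ c → c + c + 6 ≤ L
  2c+6≤L 10≤c = begin
    c + c + 6               ≤⟨ +-monoʳ-≤ (c + c) (n≤1+n 6) ⟩
    c + c + 7               ≤⟨ m≤n*m (c + c + 7) (c + 3) {{>-nonZero (≤-trans (s≤s z≤n) (m≤n+m 3 c))}} ⟩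
    (c + 3) * (c + c + 7)   ≤⟨ [c+3]*[2c+7]≤2^c 10≤c ⟩
    2 ^ c                   ≤⟨ ^-monoʳ-≤ 2 (m≤m+n c c) ⟩
    L                       ∎
    where open ≤-Reasoning

  window-exponent≤ : 10 ≤ c → r ≤ 2 * (L / c) + 1 → (c + c + 6) * r ≤ 17 * L
  window-exponent≤ 10≤c r≤2q+1 = begin
    (c + c + 6) * r                          ≤⟨ *-monoʳ-≤ (c + c + 6) r≤2q+1 ⟩
    (c + c + 6) * (2 * q + 1)                ≡⟨ expand c q ⟩
    4 * (c * q) + 12 * q + (c + c + 6)       ≤⟨ +-mono-≤ (+-mono-≤ (*-monoʳ-≤ 4 (subst (_≤ L) (*-comm q c) (m/n*n≤m L c)))
                                                                   (*-monoʳ-≤ 12 (m/n≤m L c)))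
                                                          (2c+6≤L 10≤c) ⟩
    4 * L + 12 * L + L                       ≡⟨ collect L ⟩
    17 * L                                   ∎
    where
    open ≤-Reasoning
    q : ℕ
    q = L / c
    expand : ∀ c q → (c + c + 6) * (2 * q + 1) ≡ 4 * (c * q) + 12 * q + (c + c + 6)
    expand = solve-∀
    collect : ∀ L → 4 * L + 12 * L + L ≡ 17 * L
    collect = solve-∀

  exponent<n∸1 : 10 ≤ c → r ≤ 2 * (L / c) + 1 → exponent < n ∸ 1
  exponent<n∸1 10≤c r≤2q+1 = ∸-monoˡ-≤ 1 (begin
    2 + exponent                           ≤⟨ +-monoʳ-≤ 2 (+-mono-≤ (smooth-exponent≤ 10≤c) (+-monoʳ-≤ (L + L) (window-exponent≤ 10≤c r≤2q+1))) ⟩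
    2 + (8 * L + (L + L + 17 * L))         ≤⟨ +-monoˡ-≤ _ (*-monoʳ-≤ 2 L>0) ⟩
    2 * L + (8 * L + (L + L + 17 * L))     ≡⟨ collect L ⟩
    29 * L                                 ≤⟨ *-monoˡ-≤ L (m≤m+n 29 35) ⟩
    64 * L                                 ≡⟨ spread L ⟩
    n                                      ∎)
    where
    open ≤-Reasoning
    collect : ∀ L → 2 * L + (8 * L + (L + L + 17 * L)) ≡ 29 * L
    collect = solve-∀
    spread : ∀ L → 64 * L ≡ L + 63 * L
    spread = solve-∀

  primesIn-window≥ : 10 ≤ c → 2 * (L / c + 1) ≤ r
  primesIn-window≥ 10≤c with 2 * (L / c + 1) ≤? r
  ... | yes enough = enough
  ... | no  few    = contradiction 2^[n∸1]≤2^exponent (<⇒≱ (^-monoʳ-< 2 ≤-refl (exponent<n∸1 10≤c r≤2q+1)))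
    where
    r≤2q+1 : r ≤ 2 * (L / c) + 1
    r≤2q+1 = s≤s⁻¹ (subst (r <_) (double (L / c)) (≰⇒> few))
      where
      double : ∀ q → 2 * (q + 1) ≡ suc (2 * q + 1)
      double = solve-∀

open ChebyshevWindow using (primesIn-window≥)

-- Chinese remainder codes

hamming-sym : ∀ {n} (u v : Fin n → ℕ) → hamming u v ≡ hamming v u
hamming-sym {zero}  u v = refl
hamming-sym {suc n} u v with u zero ≟ v zero | v zero ≟ u zero
... | yes _   | yes _   = hamming-sym (u ∘ suc) (v ∘ suc)
... | no  _   | no  _   = cong suc (hamming-sym (u ∘ suc) (v ∘ suc))
... | yes u≡v | no  v≢u = contradiction (sym u≡v) v≢u
... | no  u≢v | yes v≡u = contradiction (sym v≡u) u≢v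

hamming-tail≤ : ∀ {n} (u v : Fin (suc n) → ℕ) → hamming (u ∘ suc) (v ∘ suc) ≤ hamming u v
hamming-tail≤ u v with u zero ≟ v zero
... | yes _ = ≤-refl
... | no  _ = n≤1+n _

hamming-triangle : ∀ {n} (u v w : Fin n → ℕ) → hamming u w ≤ hamming u v + hamming v w
hamming-triangle {zero}  u v w = z≤n
hamming-triangle {suc n} u v w with u zero ≟ w zero
... | yes _ = ≤-trans (hamming-triangle (u ∘ suc) (v ∘ suc) (w ∘ suc)) (+-mono-≤ (hamming-tail≤ u v) (hamming-tail≤ v w))
... | no u≢w with u zero ≟ v zero | v zero ≟ w zero
...   | yes u≡v | yes v≡w = contradiction (trans u≡v v≡w) u≢w
...   | no  _   | yes _   = s≤s (hamming-triangle (u ∘ suc) (v ∘ suc) (w ∘ suc))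
...   | no  _   | no  _   = s≤s (≤-trans (hamming-triangle (u ∘ suc) (v ∘ suc) (w ∘ suc)) (+-monoʳ-≤ _ (n≤1+n _)))
...   | yes _   | no  _   = ≤-trans (s≤s (hamming-triangle (u ∘ suc) (v ∘ suc) (w ∘ suc))) (≤-reflexive (sym (+-suc _ _)))

agreeing : ∀ {n} → (Fin n → ℕ) → (Fin n → ℕ) → (Fin n → ℕ) → List ℕ
agreeing {zero}  p u v = []
agreeing {suc n} p u v with u zero ≟ v zero
... | yes _ = p zero ∷ agreeing (p ∘ suc) (u ∘ suc) (v ∘ suc)
... | no  _ = agreeing (p ∘ suc) (u ∘ suc) (v ∘ suc)

length-agreeing+hamming : ∀ {n} (p u v : Fin n → ℕ) → length (agreeing p u v) + hamming u v ≡ n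
length-agreeing+hamming {zero}  p u v = refl
length-agreeing+hamming {suc n} p u v with u zero ≟ v zero
... | yes _ = cong suc (length-agreeing+hamming (p ∘ suc) (u ∘ suc) (v ∘ suc))
... | no  _ = trans (+-suc _ _) (cong suc (length-agreeing+hamming (p ∘ suc) (u ∘ suc) (v ∘ suc)))

agreeing-all : ∀ {n} {P : ℕ → Set} (p u v : Fin n → ℕ) → (∀ i → u i ≡ v i → P (p i)) → All P (agreeing p u v)
agreeing-all {zero}  p u v P[p] = []
agreeing-all {suc n} p u v P[p] with u zero ≟ v zero
... | yes u≡v = P[p] zero u≡v ∷ agreeing-all (p ∘ suc) (u ∘ suc) (v ∘ suc) (P[p] ∘ suc)
... | no  _   = agreeing-all (p ∘ suc) (u ∘ suc) (v ∘ suc) (P[p] ∘ suc)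

agreeing-increasing : ∀ {n} (p u v : Fin n → ℕ) → StrictlyIncreasing p → AllPairs _<_ (agreeing p u v)
agreeing-increasing {zero}  p u v inc = []
agreeing-increasing {suc n} p u v inc with u zero ≟ v zero
... | yes _ = agreeing-all (p ∘ suc) (u ∘ suc) (v ∘ suc) (λ i _ → inc zero (suc i) z<s)
            ∷ agreeing-increasing (p ∘ suc) (u ∘ suc) (v ∘ suc) (λ i j i<j → inc (suc i) (suc j) (s<s i<j))
... | no  _ = agreeing-increasing (p ∘ suc) (u ∘ suc) (v ∘ suc) (λ i j i<j → inc (suc i) (suc j) (s<s i<j))

modℕ-≡⇒∣∸ : ∀ {x m m′} → 0 < x → modℕ m x ≡ modℕ m′ x → m ≤ m′ → x ∣ m′ ∸ m
modℕ-≡⇒∣∸ {suc k} {m} {m′} _ m%x≡m′%x m≤m′ = divides (m′ / x ∸ m / x) (begin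
  m′ ∸ m                                                ≡⟨ cong₂ _∸_ (m≡m%n+[m/n]*n m′ x) (m≡m%n+[m/n]*n m x) ⟩
  (m′ % x + (m′ / x) * x) ∸ (m % x + (m / x) * x)       ≡⟨ cong (λ r → (r + (m′ / x) * x) ∸ (m % x + (m / x) * x)) m%x≡m′%x ⟨
  (m % x + (m′ / x) * x) ∸ (m % x + (m / x) * x)        ≡⟨ [m+n]∸[m+o]≡n∸o (m % x) _ _ ⟩
  (m′ / x) * x ∸ (m / x) * x                            ≡⟨ *-distribʳ-∸ x (m′ / x) (m / x) ⟨
  (m′ / x ∸ m / x) * x                                  ∎)
  where
  open ≡-Reasoning
  x : ℕ
  x = suc k

-- The primes at the coordinates where the encodings of m ≤ m′ agree all divide m′ − m.
crtEncode-injective-≤ : ∀ {n} {p : Fin n → ℕ} {Q T m m′} → (∀ i → Prime (p i)) → StrictlyIncreasing p →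
                        (∀ i → Q ≤ p i) → m ≤ m′ → m′ < T →
                        T ≤ Q ^ (n ∸ hamming (crtEncode p m) (crtEncode p m′)) → m ≡ m′
crtEncode-injective-≤ {n} {p} {Q} {T} {m} {m′} prime inc Q≤ m≤m′ m′<T T≤Q^agreements with m′ ∸ m in m′∸m≡
... | zero   = ≤-antisym m≤m′ (m∸n≡0⇒m≤n m′∸m≡)
... | suc d  = contradiction (begin-strict
  Q ^ (n ∸ h)           ≡⟨ cong (Q ^_) (trans (sym (m+n∸n≡m (length A) h)) (cong (_∸ h) (length-agreeing+hamming p u v))) ⟨
  Q ^ length A          ≤⟨ ^length≤product (agreeing-all p u v (λ i _ → Q≤ i)) ⟩
  product A             ≤⟨ ∣⇒≤ (subst (product A ∣_) m′∸m≡ A∣m′∸m) ⟩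
  suc d                 ≡⟨ m′∸m≡ ⟨
  m′ ∸ m                ≤⟨ m∸n≤m m′ m ⟩
  m′                    <⟨ m′<T ⟩
  T                     ∎) (≤⇒≯ T≤Q^agreements)
  where
  open ≤-Reasoning
  u v : Fin n → ℕ
  u = crtEncode p m
  v = crtEncode p m′
  h : ℕ
  h = hamming u v
  A : List ℕ
  A = agreeing p u v
  A∣m′∸m : product A ∣ m′ ∸ m
  A∣m′∸m = product-primes∣ (agreeing-all p u v (λ i _ → prime i)) (AllPairs.map <⇒≢ (agreeing-increasing p u v inc))
             (agreeing-all p u v (λ i uᵢ≡vᵢ → modℕ-≡⇒∣∸ (<-trans z<s (prime⇒2≤ (prime i))) uᵢ≡vᵢ m≤m′))

crtEncode-injective : ∀ {n} {p : Fin n → ℕ} {Q T m m′} → (∀ i → Prime (p i)) → StrictlyIncreasing p →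
                      (∀ i → Q ≤ p i) → m < T → m′ < T →
                      T ≤ Q ^ (n ∸ hamming (crtEncode p m) (crtEncode p m′)) → m ≡ m′
crtEncode-injective {n} {p} {m = m} {m′} prime inc Q≤ m<T m′<T T≤ with ≤-total m m′
... | inj₁ m≤m′ = crtEncode-injective-≤ prime inc Q≤ m≤m′ m′<T T≤
... | inj₂ m′≤m = sym (crtEncode-injective-≤ prime inc Q≤ m′≤m m<T
                        (subst (λ h → _ ≤ _ ^ (n ∸ h)) (hamming-sym (crtEncode p m) (crtEncode p m′)) T≤))

-- a message whose codeword lies within distance d / 2 of w, or 0 if there is none
decodeWithin : ∀ {n} → (Fin n → ℕ) → ℕ → ℕ → (Fin n → ℕ) → ℕ
decodeWithin p T d w with any? {n = T} (λ i → 2 * hamming w (crtEncode p (toℕ i)) ≤? d)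
... | yes (i , _) = toℕ i
... | no  _       = 0

correctsErrors-of-distance : ∀ {n} (p : Fin n → ℕ) T d →
  (∀ {m m′} → m < T → m′ < T → hamming (crtEncode p m) (crtEncode p m′) ≤ d → m ≡ m′) →
  CorrectsErrors p T (λ e → 2 * e ≤ d)
correctsErrors-of-distance p T d separated = decodeWithin p T d , decodes
  where
  decodes : ∀ m → m < T → ∀ w → 2 * hamming w (crtEncode p m) ≤ d → decodeWithin p T d w ≡ m
  decodes m m<T w 2e≤d with any? {n = T} (λ i → 2 * hamming w (crtEncode p (toℕ i)) ≤? d)
  ... | yes (i , 2e′≤d) = separated (toℕ<n i) m<T (*-cancelˡ-≤ 2 (begin
    2 * hamming (crtEncode p (toℕ i)) (crtEncode p m)                         ≤⟨ *-monoʳ-≤ 2 (hamming-triangle _ w _) ⟩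
    2 * (hamming (crtEncode p (toℕ i)) w + hamming w (crtEncode p m))         ≡⟨ *-distribˡ-+ 2 (hamming (crtEncode p (toℕ i)) w) _ ⟩
    2 * hamming (crtEncode p (toℕ i)) w + 2 * hamming w (crtEncode p m)       ≡⟨ cong (λ e → 2 * e + _) (hamming-sym _ w) ⟩
    2 * hamming w (crtEncode p (toℕ i)) + 2 * hamming w (crtEncode p m)       ≤⟨ +-mono-≤ 2e′≤d 2e≤d ⟩
    d + d                                                                     ≡⟨ cong (d +_) (+-identityʳ d) ⟨
    2 * d                                                                     ∎))
    where open ≤-Reasoning
  ... | no  none        = contradiction (fromℕ< m<T , subst (λ x → 2 * hamming w (crtEncode p x) ≤ d) (sym (toℕ-fromℕ< m<T)) 2e≤d) none

correctsErrors-mono : ∀ {n} {p : Fin n → ℕ} {T} {A B : ℕ → Set} → (∀ {e} → A e → B e) →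
                      CorrectsErrors p T B → CorrectsErrors p T A
correctsErrors-mono A⇒B (decode , decodes) = decode , λ m m<T w a → decodes m m<T w (A⇒B a)

lookup-increasing : ∀ {xs} → AllPairs _<_ xs → StrictlyIncreasing (lookup xs)
lookup-increasing {_ ∷ _} (x<xs ∷ _)   zero    (suc j) _         = All.lookup x<xs (∈-lookup j)
lookup-increasing {_ ∷ _} (_ ∷ sorted) (suc i) (suc j) (s<s i<j) = lookup-increasing sorted i j i<j

inject≤-increasing : ∀ {m n} {p : Fin n → ℕ} .(m≤n : m ≤ n) → StrictlyIncreasing p → StrictlyIncreasing (λ i → p (inject≤ {m} {n} i m≤n))
inject≤-increasing m≤n inc i j i<j = inc _ _ (subst₂ _<_ (sym (toℕ-inject≤ i m≤n)) (sym (toℕ-inject≤ j m≤n)) i<j)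

^≤prodF : ∀ {n Q} (f : Fin n → ℕ) → (∀ i → Q ≤ f i) → Q ^ n ≤ prodF f
^≤prodF {zero}  f Q≤f = ≤-refl
^≤prodF {suc n} f Q≤f = *-mono-≤ (Q≤f zero) (^≤prodF (f ∘ suc) (Q≤f ∘ suc))

-- Since T ≤ Q ^ K, codewords of distinct messages differ in more than K places.
crtCode-of-large-primes : ∀ {K Q T} .{{_ : NonZero Q}} (p : Fin (K + K) → ℕ) → 0 < K → (∀ i → Prime (p i)) →
                          StrictlyIncreasing p → (∀ i → Q ≤ p i) → T ≤ Q ^ K →
                          IsRateHalfCRTCode K p T × CorrectsErrors p T (λ e → 2 * e ≤ K)
crtCode-of-large-primes {K} {Q} {T} p K>0 prime inc Q≤ T≤Q^K =
  (K>0 , prime , inc , ≤-trans T≤Q^K (^≤prodF (λ i → p (i ↑ˡ K)) (λ i → Q≤ (i ↑ˡ K)))) ,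
  correctsErrors-of-distance p T K separated
  where
  separated : ∀ {m m′} → m < T → m′ < T → hamming (crtEncode p m) (crtEncode p m′) ≤ K → m ≡ m′
  separated {m} {m′} m<T m′<T h≤K = crtEncode-injective prime inc Q≤ m<T m′<T (≤-trans T≤Q^K (^-monoʳ-≤ Q (begin
    K                                               ≡⟨ m+n∸n≡m K K ⟨
    K + K ∸ K                                       ≤⟨ ∸-monoʳ-≤ (K + K) h≤K ⟩
    K + K ∸ hamming (crtEncode p m) (crtEncode p m′) ∎)))
    where open ≤-Reasoning

-- Choice of parameters

n<2^[1+⌊log₂n⌋] : ∀ n → n < 2 ^ suc ⌊log₂ n ⌋
n<2^[1+⌊log₂n⌋] n = ≰⇒> λ 2^[1+log]≤n →
  <-irrefl refl (≤-trans (≤-reflexive (sym (⌊log₂[2^n]⌋≡n (suc ⌊log₂ n ⌋)))) (⌊log₂⌋-mono-≤ 2^[1+log]≤n))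

2^⌊log₂n⌋≤n : ∀ n → 0 < n → 2 ^ ⌊log₂ n ⌋ ≤ n
2^⌊log₂n⌋≤n = <-rec _ bound
  where
  bound : ∀ n → (∀ {m} → m < n → 0 < m → 2 ^ ⌊log₂ m ⌋ ≤ m) → 0 < n → 2 ^ ⌊log₂ n ⌋ ≤ n
  bound 1             _   _ = ≤-refl
  bound n@(suc (suc k)) rec _ = begin
    2 ^ ⌊log₂ n ⌋                  ≡⟨ cong (2 ^_) (trans (+-comm 1 _) (m∸n+n≡m 1≤log)) ⟨
    2 * 2 ^ (⌊log₂ n ⌋ ∸ 1)        ≡⟨ cong (λ e → 2 * 2 ^ e) (⌊log₂⌊n/2⌋⌋≡⌊log₂n⌋∸1 n) ⟨
    2 * 2 ^ ⌊log₂ ⌊ n /2⌋ ⌋        ≤⟨ *-monoʳ-≤ 2 (rec (⌊n/2⌋<n (suc k)) z<s) ⟩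
    2 * ⌊ n /2⌋                    ≡⟨ cong (⌊ n /2⌋ +_) (+-identityʳ _) ⟩
    ⌊ n /2⌋ + ⌊ n /2⌋              ≤⟨ +-monoʳ-≤ ⌊ n /2⌋ (⌊n/2⌋≤⌈n/2⌉ n) ⟩
    ⌊ n /2⌋ + ⌈ n /2⌉              ≡⟨ ⌊n/2⌋+⌈n/2⌉≡n n ⟩
    n                              ∎
    where
    open ≤-Reasoning
    1≤log : 1 ≤ ⌊log₂ n ⌋
    1≤log = ⌊log₂⌋-mono-≤ {2} {n} (s≤s (s≤s z≤n))

2^k≤n⇒k≤⌊log₂n⌋ : ∀ {k n} → 2 ^ k ≤ n → k ≤ ⌊log₂ n ⌋
2^k≤n⇒k≤⌊log₂n⌋ {k} 2^k≤n = subst (_≤ _) (⌊log₂[2^n]⌋≡n k) (⌊log₂⌋-mono-≤ 2^k≤n)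

m<n*[m/n+1] : ∀ m n .{{_ : NonZero n}} → m < n * (m / n + 1)
m<n*[m/n+1] m n = begin-strict
  m                       ≡⟨ m≡m%n+[m/n]*n m n ⟩
  m % n + m / n * n       <⟨ +-monoˡ-< _ (m%n<n m n) ⟩
  n + m / n * n           ≡⟨ regroup n (m / n) ⟩
  n * (m / n + 1)         ∎
  where
  open ≤-Reasoning
  regroup : ∀ n q → n + q * n ≡ n * (q + 1)
  regroup = solve-∀

2^L≤L^[L/c+1] : ∀ c .{{_ : NonZero c}} → 2 ^ 2 ^ (c + c) ≤ (2 ^ (c + c)) ^ (2 ^ (c + c) / c + 1)
2^L≤L^[L/c+1] c = begin
  2 ^ L                   ≤⟨ ^-monoʳ-≤ 2 (≤-trans (<⇒≤ (m<n*[m/n+1] L c)) (*-monoˡ-≤ _ (m≤m+n c c))) ⟩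
  2 ^ ((c + c) * K)       ≡⟨ ^-*-assoc 2 (c + c) K ⟨
  L ^ K                   ∎
  where
  open ≤-Reasoning
  L K : ℕ
  L = 2 ^ (c + c)
  K = L / c + 1

⌊n/2⌋+⌊n/2⌋≤n : ∀ n → ⌊ n /2⌋ + ⌊ n /2⌋ ≤ n
⌊n/2⌋+⌊n/2⌋≤n n = ≤-trans (+-monoʳ-≤ ⌊ n /2⌋ (⌊n/2⌋≤⌈n/2⌉ n)) (≤-reflexive (⌊n/2⌋+⌈n/2⌉≡n n))

n≤1+⌊n/2⌋+⌊n/2⌋ : ∀ n → n ≤ suc (⌊ n /2⌋ + ⌊ n /2⌋)
n≤1+⌊n/2⌋+⌊n/2⌋ n = begin
  n                            ≡⟨ ⌊n/2⌋+⌈n/2⌉≡n n ⟨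
  ⌊ n /2⌋ + ⌈ n /2⌉            ≤⟨ +-monoʳ-≤ ⌊ n /2⌋ (⌊n/2⌋-mono (n≤1+n (suc n))) ⟩
  ⌊ n /2⌋ + suc ⌊ n /2⌋        ≡⟨ +-suc ⌊ n /2⌋ ⌊ n /2⌋ ⟩
  suc (⌊ n /2⌋ + ⌊ n /2⌋)      ∎
  where open ≤-Reasoning

-- 4 ^ c is the least power of 4 exceeding a
windowExponent : ℕ → ℕ
windowExponent a = ⌊ ⌊log₂ a ⌋ /2⌋ + 1

a<2^[2·windowExponent] : ∀ a → a < 2 ^ (windowExponent a + windowExponent a)
a<2^[2·windowExponent] a = <-≤-trans (n<2^[1+⌊log₂n⌋] a) (^-monoʳ-≤ 2 (begin
  suc b                         ≤⟨ s≤s (n≤1+⌊n/2⌋+⌊n/2⌋ b) ⟩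
  2 + (⌊ b /2⌋ + ⌊ b /2⌋)       ≡⟨ regroup ⌊ b /2⌋ ⟩
  (⌊ b /2⌋ + 1) + (⌊ b /2⌋ + 1) ∎))
  where
  open ≤-Reasoning
  b : ℕ
  b = ⌊log₂ a ⌋
  regroup : ∀ h → 2 + (h + h) ≡ (h + 1) + (h + 1)
  regroup = solve-∀

2^[2·windowExponent]≤4a : ∀ a → 0 < a → 2 ^ (windowExponent a + windowExponent a) ≤ 4 * a
2^[2·windowExponent]≤4a a a>0 = begin
  2 ^ ((⌊ b /2⌋ + 1) + (⌊ b /2⌋ + 1))   ≡⟨ cong (2 ^_) (regroup ⌊ b /2⌋) ⟩
  2 ^ (⌊ b /2⌋ + ⌊ b /2⌋ + 2)           ≤⟨ ^-monoʳ-≤ 2 (+-monoˡ-≤ 2 (⌊n/2⌋+⌊n/2⌋≤n b)) ⟩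
  2 ^ (b + 2)                           ≡⟨ ^-distribˡ-+-* 2 b 2 ⟩
  2 ^ b * 4                             ≤⟨ *-monoˡ-≤ 4 (2^⌊log₂n⌋≤n a a>0) ⟩
  a * 4                                 ≡⟨ *-comm a 4 ⟩
  4 * a                                 ∎
  where
  open ≤-Reasoning
  b : ℕ
  b = ⌊log₂ a ⌋
  regroup : ∀ h → (h + 1) + (h + 1) ≡ h + h + 2
  regroup = solve-∀

withinFraction⇒2e≤K : ∀ {K T e} → 0 < loglog T → WithinFraction 0 (K + K) T e → 2 * e ≤ K
withinFraction⇒2e≤K {K} {T} {e} ℓ>0 within = *-cancelˡ-≤ 2 (begin
  2 * (2 * e)       ≡⟨ *-assoc 2 2 e ⟨
  4 * e             ≤⟨ *-cancelʳ-≤ (4 * e) (K + K) (loglog T) {{>-nonZero ℓ>0}} (≤-trans (m≤m+n _ 0) within) ⟩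
  K + K             ≡⟨ cong (K +_) (+-identityʳ K) ⟨
  2 * K             ∎)
  where open ≤-Reasoning

2^q-range : ∀ {T q} → 0 < T → ⌊log₂ T ⌋ < q → q < 500 * ⌊log₂ T ⌋ → T < 2 ^ q × 2 ^ q < T ^ 500
2^q-range {T} {q} T>0 a<q q<500a = <-≤-trans (n<2^[1+⌊log₂n⌋] T) (^-monoʳ-≤ 2 a<q) , (begin-strict
  2 ^ q                   <⟨ ^-monoʳ-< 2 ≤-refl q<500a ⟩
  2 ^ (500 * a)           ≡⟨ cong (2 ^_) (*-comm 500 a) ⟩
  2 ^ (a * 500)           ≡⟨ ^-*-assoc 2 a 500 ⟨
  (2 ^ a) ^ 500           ≤⟨ ^-monoˡ-≤ 500 (2^⌊log₂n⌋≤n T T>0) ⟩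
  T ^ 500                 ∎)
  where
  open ≤-Reasoning
  a : ℕ
  a = ⌊log₂ T ⌋

q≤64L⇒q<500a : ∀ {a L q} → 0 < a → L ≤ 4 * a → q ≤ L + 63 * L → q < 500 * a
q≤64L⇒q<500a {a} {L} {q} a>0 L≤4a q≤64L = begin-strict
  q                 ≤⟨ q≤64L ⟩
  L + 63 * L        ≡⟨ collect L ⟩
  64 * L            ≤⟨ *-monoʳ-≤ 64 L≤4a ⟩
  64 * (4 * a)      ≡⟨ *-assoc 64 4 a ⟨
  256 * a           <⟨ *-monoˡ-< a {{>-nonZero a>0}} (m≤m+n 257 243) ⟩
  500 * a           ∎
  where
  open ≤-Reasoning
  collect : ∀ L → L + 63 * L ≡ 64 * L
  collect = solve-∀

-- T ≥ 2 ^ 2 ^ 18 makes c ≥ 10, where the estimates of ChebyshevWindow hold.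
module WindowCode (T : ℕ) (T₀≤T : 2 ^ 2 ^ 18 ≤ T) where

  a c L K : ℕ
  a = ⌊log₂ T ⌋
  c = windowExponent a
  L = 2 ^ (c + c)

  instance
    c≢0 : NonZero c
    c≢0 = >-nonZero (m≤n+m 1 _)

  K = L / c + 1

  2^18≤a : 2 ^ 18 ≤ a
  2^18≤a = 2^k≤n⇒k≤⌊log₂n⌋ T₀≤T

  a>0 : 0 < a
  a>0 = ≤-trans (m^n>0 2 18) 2^18≤a

  T>0 : 0 < T
  T>0 = ≤-trans (m^n>0 2 (2 ^ 18)) T₀≤T

  18≤loglog : 18 ≤ loglog T
  18≤loglog = 2^k≤n⇒k≤⌊log₂n⌋ {18} 2^18≤a

  10≤c : 10 ≤ c
  10≤c = +-monoˡ-≤ 1 (⌊n/2⌋-mono 18≤loglog)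

  L≤4a : L ≤ 4 * a
  L≤4a = 2^[2·windowExponent]≤4a a a>0

  K+K≤10a : K + K ≤ 10 * a
  K+K≤10a = begin
    K + K                     ≤⟨ +-mono-≤ K≤L+1 K≤L+1 ⟩
    (L + 1) + (L + 1)         ≤⟨ +-mono-≤ (+-mono-≤ L≤4a a>0) (+-mono-≤ L≤4a a>0) ⟩
    (4 * a + a) + (4 * a + a) ≡⟨ collect a ⟩
    10 * a                    ∎
    where
    open ≤-Reasoning
    K≤L+1 : K ≤ L + 1
    K≤L+1 = +-monoˡ-≤ 1 (m/n≤m L c)
    collect : ∀ a → (4 * a + a) + (4 * a + a) ≡ 10 * a
    collect = solve-∀

  W : List ℕ
  W = primesIn L (63 * L)

  K+K≤|W| : K + K ≤ length W
  K+K≤|W| = subst (_≤ length W) (cong (K +_) (+-identityʳ K))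
                  (primesIn-window≥ c 10≤c)

  p : Fin (K + K) → ℕ
  p i = lookup W (inject≤ i K+K≤|W|)

  inWindow : ∀ i → InWindow L (63 * L) (p i)
  inWindow i = All.lookup (primesIn-inWindow L (63 * L)) (∈-lookup _)

  a<p : ∀ i → a < p i
  a<p i = <-trans (a<2^[2·windowExponent] a) (proj₁ (proj₂ (inWindow i)))

  T≤L^K : T ≤ L ^ K
  T≤L^K = ≤-trans (<⇒≤ (<-≤-trans (n<2^[1+⌊log₂n⌋] T) (^-monoʳ-≤ 2 (a<2^[2·windowExponent] a)))) (2^L≤L^[L/c+1] c)

  code : IsRateHalfCRTCode K p T × CorrectsErrors p T (λ e → 2 * e ≤ K)
  code = crtCode-of-large-primes {{m^n≢0 2 (c + c)}} p (m≤n+m 1 _) (proj₁ ∘ inWindow)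
           (inject≤-increasing K+K≤|W| (lookup-increasing (primesIn-increasing L (63 * L))))
           (λ i → <⇒≤ (proj₁ (proj₂ (inWindow i)))) T≤L^K

theorem5 : ∃[ C ] ∃[ D ] ∃[ T₀ ] ∀ (T : ℕ) → T₀ ≤ T →
    ∃[ K ] Σ (Fin (K + K) → ℕ) λ p →
      IsRateHalfCRTCode K p T
      × K + K ≤ C * ⌊log₂ T ⌋
      × (∀ i → T < 2 ^ p i × 2 ^ p i < T ^ 500)
      × CorrectsErrors p T (WithinFraction D (K + K) T)
theorem5 = 10 , 0 , 2 ^ 2 ^ 18 , λ T T₀≤T → let open WindowCode T T₀≤T in
  K , p , proj₁ code , K+K≤10a ,
  (λ i → 2^q-range T>0 (a<p i) (q≤64L⇒q<500a a>0 L≤4a (proj₂ (proj₂ (inWindow i))))) ,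
  correctsErrors-mono {p = p} (λ {e} → withinFraction⇒2e≤K {K} {T} {e} (<-≤-trans z<s 18≤loglog)) (proj₂ code)
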